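{- Let $\beta_1,\beta_2,\dots$ be an enumeration of $\mathbb{Q}/\mathbb{Z}$, i.e. $n\mapsto\beta_n$ is a bijection from the positive integers onto $\mathbb{Q}/\mathbb{Z}$. Then the enumeration is admissible if and only if, for every positive integer $n$, the function $f_{\beta_n}$ is $\mathcal{B}_n$-measurable.
   Context: Every $\beta\in\mathbb{Q}/\mathbb{Z}$ can be written $\beta=a/q$ with $q\ge1$ and $\gcd(a,q)=1$; its height is $h(\beta)=q$. Put $\mathcal{F}_Q=\{\beta:h(\beta)\le Q\}$. For distinct $a,b\in\mathbb{R}/\mathbb{Z}$, $I(a,b)$ is the open arc from $a$ to $b$ in the positive direction, i.e. $\{a+t\bmod1:0<t<d\}$ with $d\in(0,1)$, $d\equiv b-a\pmod1$. $\overline{I}(a,b)$ is its closure. For $\beta\ne0$ with $h(\beta)=Q$: $\beta'$ is the unique point of $\mathcal{F}_Q$ with $I(\beta',\beta)\cap\mathcal{F}_Q=\emptyset$, and $\beta''$ is the unique point of $\mathcal{F}_Q$ with $I(\beta,\beta'')\cap\mathcal{F}_Q=\emptyset$. Let $\psi(x)=x-[x]-\frac12$ for $x\notin\mathbb{Z}$ and $\psi(x)=0$ for $x\in\mathbb{Z}$. Define $f_0\equiv1$ and, for $\beta\ne0$, $f_\beta(x)=h(\beta)\psi(x-\beta)-h(\beta')\psi(x-\beta')-h(\beta'')\psi(x-\beta'')$. An enumeration $\beta_1,\beta_2,\dots$ of $\mathbb{Q}/\mathbb{Z}$ is admissible if all three of the following hold: (i) $\beta_1=0$; (ii) whenever $m\ge2$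 and $\beta_k=\beta_m'$, we have $k<m$; (iii) whenever $m\ge2$ and $\beta_l=\beta_m''$, we have $l<m$. $\mathcal{B}_n$ is the finite $\sigma$-algebra of subsets of $\mathbb{R}/\mathbb{Z}$ generated by the connected components of $\mathbb{R}/\mathbb{Z}\setminus\{\beta_1,\dots,\beta_n\}$ together with the singletons $\{\beta_1\},\dots,\{\beta_n\}$.
   Formalization: The functions $f_{\beta_n}$ and the connected components of $\mathbb{R}/\mathbb{Z}\setminus\{\beta_1,\dots,\beta_n\}$ in the $\mathcal{B}_n$-measurability condition are evaluated only at points of ℚ/ℤ instead of ℝ/ℤ. -}

module Defs where

open import Data.Nat as ℕ using (ℕ; _≟_)
open import Data.Integer as ℤ using (ℤ; +_)
open import Data.Rational using (ℚ; ↧ₙ_; 0ℚ; 1ℚ; ½; floor; _-_; _+_; _*_; _≤_; _<_)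
import Data.Rational as Q
open import Data.Product using (Σ; _×_; ∃)
open import Data.Sum using (_⊎_)
open import Data.Empty using (⊥)
open import Relation.Nullary using (¬_; yes; no)
open import Relation.Binary.PropositionalEquality using (_≡_; _≢_)

-- ℚ/ℤ is represented by the canonical representatives r ∈ ℚ with 0 ≤ r < 1.
-- (Data.Rational.ℚ is normalised, so _≡_ is the right equality.)
InUnit : ℚ → Set
InUnit r = (0ℚ ≤ r) × (r < 1ℚ)

height : ℚ → ℕ
height r = ↧ₙ r

ι : ℕ → ℚ
ι n = (+ n) Q./ 1

-- x lies in the open positive arc I(a,b) (a, b, x representatives in [0,1))
InArc : ℚ → ℚ → ℚ → Set
InArc a b x = ((a < b) × (a < x) × (x < b)) ⊎ ((b < a) × ((a < x) ⊎ (x < b)))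

IsLeftNbr : ℚ → ℚ → Set
IsLeftNbr β γ = InUnit γ × (height γ ℕ.≤ height β) × (γ ≢ β)
  × (∀ δ → InUnit δ → height δ ℕ.≤ height β → ¬ InArc γ β δ)

IsRightNbr : ℚ → ℚ → Set
IsRightNbr β γ = InUnit γ × (height γ ℕ.≤ height β) × (γ ≢ β)
  × (∀ δ → InUnit δ → height δ ℕ.≤ height β → ¬ InArc β γ δ)

ψ : ℚ → ℚ
ψ x with ↧ₙ x ≟ 1
... | yes _ = 0ℚ
... | no _  = (x - (floor x Q./ 1)) - ½

-- f_β for β ≠ 0, given β' and β''
fβ : (β β′ β″ : ℚ) → ℚ → ℚ
fβ β β′ β″ x = ((ι (height β) * ψ (x - β)) - (ι (height β′) * ψ (x - β′)))
               - (ι (height β″) * ψ (x - β″))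

f0 : ℚ → ℚ
f0 _ = 1ℚ

-- An enumeration: e : ℕ → ℚ/ℤ bijective.  Paper's β_{n} is  e (n - 1).
IsEnumeration : (ℕ → ℚ) → Set
IsEnumeration e = (∀ n → InUnit (e n))
  × (∀ m n → e m ≡ e n → m ≡ n)
  × (∀ r → InUnit r → ∃ λ n → e n ≡ r)

-- admissibility (indices shifted by one: paper's m ≥ 2 is our m ≥ 1)
Admissible : (ℕ → ℚ) → Set
Admissible e = (e 0 ≡ 0ℚ)
  × (∀ m k → 1 ℕ.≤ m → IsLeftNbr (e m) (e k) → k ℕ.< m)
  × (∀ m l → 1 ℕ.≤ m → IsRightNbr (e m) (e l) → l ℕ.< m)

-- the point s is among paper's β_1 … β_{n+1}, i.e. e 0 … e n
InFirst : (ℕ → ℚ) → ℕ → ℚ → Set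
InFirst e n s = Σ ℕ λ k → (k ℕ.≤ n) × (e k ≡ s)

-- x and y lie in the same connected component of ℝ/ℤ ∖ {e 0,…,e n}
SameComponent : (ℕ → ℚ) → ℕ → ℚ → ℚ → Set
SameComponent e n x y = (¬ InFirst e n x) × (¬ InFirst e n y)
  × ((∀ s → InFirst e n s → ¬ InArc x y s) ⊎ (∀ s → InFirst e n s → ¬ InArc y x s))

-- g is measurable w.r.t. the finite σ-algebra B_{n+1} generated by the
-- components and the singletons {e 0},…,{e n}: g is constant on each atom
-- (singleton atoms impose no condition).
Measurable : (ℕ → ℚ) → ℕ → (ℚ → ℚ) → Set
Measurable e n g = ∀ x y → InUnit x → InUnit y → SameComponent e n x y → g x ≡ g y

FMeasurable : (ℕ → ℚ) → ℕ → Set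
FMeasurable e n = (e n ≡ 0ℚ → Measurable e n f0)
  × (e n ≢ 0ℚ → ∀ β′ β″ → IsLeftNbr (e n) β′ → IsRightNbr (e n) β″
       → Measurable e n (fβ (e n) β′ β″))

{-# OPTIONS --safe #-}
module Submission where

-- For points x, γ of [0, 1) with x ≢ γ we have ψ (x - γ) = (x - γ - ½) + [x < γ]. The Farey
-- neighbours of β satisfy h(β) = h(β′) + h(β″): they are the fractions adjacent to β, obtained
-- from an inverse of the numerator of β modulo h(β), and a fraction strictly between two
-- adjacent ones has a larger denominator than both. Hence the linear parts of f_β cancel, and
-- up to a constant f_β is the step function h(β)[x < β] - h(β′)[x < β′] - h(β″)[x < β″], which
-- jumps at each of β, β′ and β″. So f_{β_n} is B_n-measurable exactly when β′ and β″ are among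
-- β_1 … β_n (given β_1 = 0): then it is constant on every component, and otherwise a small
-- window around the late neighbour lies inside one component while f jumps across it. The same
-- window argument at n = 1 forces β_1 = 0.

open import Defs
open import Data.Nat as ℕ using (ℕ; zero; suc; z≤n; s≤s; NonZero)
import Data.Nat.Properties as ℕ
open import Data.Nat.Coprimality as Coprime using (Coprime; coprime-Bézout)
open import Data.Nat.Divisibility using (_∣_; ∣-trans; ∣1⇒≡1; ∣m+n∣m⇒∣n; m∣m*n; n∣m*n)
open import Data.Nat.DivMod
  using (_%_; _/_; %-distribˡ-*; m%n%n≡m%n; [m+kn]%n≡m%n; m<n⇒m%n≡m; m%n<n; m≡m%n+[m/n]*n; m<n⇒m/n≡0)
open import Data.Nat.GCD using (module Bézout)
import Data.Nat.Solver as ℕ-Solver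
open import Data.Integer as ℤ using (+_; -[1+_])
import Data.Integer.Properties as ℤ
import Data.Integer.Solver as ℤ-Solver
open import Data.Rational as ℚ
  using (ℚ; mkℚ; ↥_; ↧_; ↧ₙ_; 0ℚ; 1ℚ; ½; floor; _+_; _*_; _-_; -_; _<_; _≤_; _<?_; _⊔_; _⊓_; *<*)
import Data.Rational.Properties as ℚ
open import Data.Rational.Solver using (module +-*-Solver)
open import Algebra.Properties.Group ℚ.+-0-group using (∙-cancelˡ; identityʳ-unique)
open import Data.List using (List; []; _∷_; applyUpTo)
open import Data.List.Relation.Unary.All as All using (All; []; _∷_)
open import Data.List.Relation.Unary.All.Properties using (applyUpTo⁻)
open import Data.Product using (_×_; _,_; proj₁; proj₂; ∃; ∃₂)
open import Data.Sum as Sum using (_⊎_; inj₁; inj₂; [_,_]′)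
open import Data.Empty using (⊥; ⊥-elim)
open import Function using (_∘_)
open import Relation.Nullary using (¬_; yes; no)
open import Relation.Nullary.Decidable using (decidable-stable)
open import Relation.Binary.PropositionalEquality
open import Relation.Binary.Definitions using (tri<; tri≈; tri>)

<⇒≢ : ∀ {p q} → p < q → p ≢ q
<⇒≢ p<q p≡q = ℚ.<-irrefl p≡q p<q

<-connex : ∀ {p q} → p ≢ q → p < q ⊎ q < p
<-connex {p} {q} p≢q with ℚ.<-cmp p q
... | tri< p<q _ _ = inj₁ p<q
... | tri≈ _ p≡q _ = ⊥-elim (p≢q p≡q)
... | tri> _ _ q<p = inj₂ q<p

≤∧≢⇒< : ∀ {p q} → p ≤ q → p ≢ q → p < q
≤∧≢⇒< p≤q p≢q = [ (λ p<q → p<q) , (λ q<p → ⊥-elim (ℚ.<-irrefl refl (ℚ.<-≤-trans q<p p≤q))) ]′ (<-connex p≢q)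

≢∧≮⇒> : ∀ {p q} → p ≢ q → ¬ (p < q) → q < p
≢∧≮⇒> p≢q p≮q = [ (λ p<q → ⊥-elim (p≮q p<q)) , (λ q<p → q<p) ]′ (<-connex p≢q)

0<1 : 0ℚ < 1ℚ
0<1 = *<* (ℤ.+<+ ℕ.z<s)

0<mkℚ⇒0<n : ∀ {n d} .{c : Coprime n (suc d)} → 0ℚ < mkℚ (+ n) d c → 0 ℕ.< n
0<mkℚ⇒0<n {n} (*<* 0<n*1) = ℤ.drop‿+<+ (subst (_ ℤ.<_) (ℤ.*-identityʳ (+ n)) 0<n*1)

mkℚ<1⇒n<1+d : ∀ {n d} .{c : Coprime n (suc d)} → mkℚ (+ n) d c < 1ℚ → n ℕ.< suc d
mkℚ<1⇒n<1+d {n} {d} (*<* n*1<1+d) =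
  ℤ.drop‿+<+ (subst₂ ℤ._<_ (ℤ.*-identityʳ (+ n)) (ℤ.*-identityˡ (+ suc d)) n*1<1+d)

ψ-nonintegral : ∀ t → ↧ₙ t ≢ 1 → ψ t ≡ (t - (floor t ℚ./ 1)) - ½
ψ-nonintegral t ↧ₙt≢1 with ↧ₙ t ℕ.≟ 1
... | yes ↧ₙt≡1 = ⊥-elim (↧ₙt≢1 ↧ₙt≡1)
... | no _      = refl

0<t<1⇒ψ[t]≡t-½ : ∀ {t} → 0ℚ < t → t < 1ℚ → ψ t ≡ t - ½
0<t<1⇒ψ[t]≡t-½ {t@(mkℚ (+ k) d _)} 0<t t<1 = begin
  ψ t                          ≡⟨ ψ-nonintegral t ↧ₙt≢1 ⟩
  (t - (floor t ℚ./ 1)) - ½    ≡⟨ cong (λ z → (t - (z ℚ./ 1)) - ½) ⌊t⌋≡0 ⟩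
  (t - 0ℚ) - ½                 ≡⟨ cong (_- ½) (ℚ.+-identityʳ t) ⟩
  t - ½                        ∎
  where
  open ≡-Reasoning
  k<1+d : k ℕ.< suc d
  k<1+d = mkℚ<1⇒n<1+d t<1
  ↧ₙt≢1 : suc d ≢ 1
  ↧ₙt≢1 refl = ℕ.<-irrefl refl (ℕ.<-≤-trans (0<mkℚ⇒0<n 0<t) (ℕ.≤-pred k<1+d))
  ⌊t⌋≡0 : floor t ≡ + 0
  ⌊t⌋≡0 rewrite m<n⇒m/n≡0 k<1+d = refl
0<t<1⇒ψ[t]≡t-½ {mkℚ -[1+ _ ] _ _} (*<* ()) _

-1<t<0⇒ψ[t]≡t+½ : ∀ {t} → - 1ℚ < t → t < 0ℚ → ψ t ≡ t + ½
-1<t<0⇒ψ[t]≡t+½ {t@(mkℚ -[1+ k ] d _)} (*<* -1-d<-1-k) _ = begin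
  ψ t                          ≡⟨ ψ-nonintegral t ↧ₙt≢1 ⟩
  (t - (floor t ℚ./ 1)) - ½    ≡⟨ cong (λ z → (t - (z ℚ./ 1)) - ½) ⌊t⌋≡-1 ⟩
  (t - - 1ℚ) - ½               ≡⟨ solve 1 (λ t → (t :- (:- con 1ℚ)) :- con ½ := t :+ con ½) refl t ⟩
  t + ½                        ∎
  where
  open ≡-Reasoning
  open +-*-Solver
  1+k<1+d : suc k ℕ.< suc d
  1+k<1+d = ℕ.s≤s (ℤ.drop‿-<- (subst₂ ℤ._<_ (ℤ.-1*i≡-i (+ suc d)) (ℤ.*-identityʳ -[1+ k ]) -1-d<-1-k))
  ↧ₙt≢1 : suc d ≢ 1
  ↧ₙt≢1 refl = ℕ.n≮0 (ℕ.≤-pred 1+k<1+d)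
  ⌊t⌋≡-1 : floor t ≡ -[1+ 0 ]
  ⌊t⌋≡-1 rewrite m<n⇒m%n≡m 1+k<1+d | m<n⇒m/n≡0 1+k<1+d = refl
-1<t<0⇒ψ[t]≡t+½ {t@(mkℚ (+ _) _ _)} _ t<0 = ⊥-elim (ℚ.<-irrefl refl (ℚ.<-≤-trans t<0 (ℚ.nonNegative⁻¹ t)))

below : ℚ → ℚ → ℚ
below x γ with x <? γ
... | yes _ = 1ℚ
... | no _  = 0ℚ

ψ[x-γ]≡x-γ-½+below : ∀ {x γ} → InUnit x → InUnit γ → x ≢ γ → ψ (x - γ) ≡ ((x - γ) - ½) + below x γ
ψ[x-γ]≡x-γ-½+below {x} {γ} (0≤x , x<1) (0≤γ , γ<1) x≢γ with x <? γ
... | yes x<γ = begin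
  ψ (x - γ)            ≡⟨ -1<t<0⇒ψ[t]≡t+½ -1<x-γ x-γ<0 ⟩
  (x - γ) + ½          ≡⟨ solve 1 (λ t → t :+ con ½ := (t :- con ½) :+ con 1ℚ) refl (x - γ) ⟩
  ((x - γ) - ½) + 1ℚ   ∎
  where
  open ≡-Reasoning
  open +-*-Solver
  x-γ<0 : x - γ < 0ℚ
  x-γ<0 = subst (x - γ <_) (ℚ.+-inverseʳ γ) (ℚ.+-monoˡ-< (- γ) x<γ)
  -1<x-γ : - 1ℚ < x - γ
  -1<x-γ = subst (_< x - γ) (ℚ.+-identityˡ (- 1ℚ)) (ℚ.+-mono-≤-< 0≤x (ℚ.neg-antimono-< γ<1))
... | no x≮γ = begin
  ψ (x - γ)            ≡⟨ 0<t<1⇒ψ[t]≡t-½ 0<x-γ x-γ<1 ⟩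
  (x - γ) - ½          ≡⟨ ℚ.+-identityʳ _ ⟨
  ((x - γ) - ½) + 0ℚ   ∎
  where
  open ≡-Reasoning
  0<x-γ : 0ℚ < x - γ
  0<x-γ = subst (_< x - γ) (ℚ.+-inverseʳ γ) (ℚ.+-monoˡ-< (- γ) (≢∧≮⇒> x≢γ x≮γ))
  x-γ<1 : x - γ < 1ℚ
  x-γ<1 = subst (x - γ <_) (ℚ.+-identityʳ 1ℚ) (ℚ.+-mono-<-≤ x<1 (ℚ.neg-antimono-≤ 0≤γ))

-- Farey neighbours

Adjacent : ℚ → ℚ → Set
Adjacent P S = ↥ S ℤ.* ↧ P ℤ.- ↥ P ℤ.* ↧ S ≡ + 1

adjacent⇒< : ∀ {P S} → Adjacent P S → P < S
adjacent⇒< {P} {S} det = *<* (ℤ.suc[i]≤j⇒i<j (ℤ.≤-reflexive 1+Y≡X))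
  where
  open ℤ-Solver.+-*-Solver
  X = ↥ S ℤ.* ↧ P
  Y = ↥ P ℤ.* ↧ S
  1+Y≡X : + 1 ℤ.+ Y ≡ X
  1+Y≡X = trans (cong (ℤ._+ Y) (sym det)) (solve 2 (λ X Y → (X :- Y) :+ Y := X) refl X Y)

-- For p/r < c/d < s/t with s r - p t = 1: d = r (s d - c t) + t (c r - p d), both brackets ≥ 1.
adjacent-gap : ∀ {P S δ} → Adjacent P S → P < δ → δ < S → ↧ₙ P ℕ.+ ↧ₙ S ℕ.≤ ↧ₙ δ
adjacent-gap {P} {S} {δ} det (*<* pd<cr) (*<* ct<sd) = ℤ.drop‿+≤+ (begin
  r ℤ.+ t                    ≡⟨ solve 3 (λ R T M → R :+ T := ((R :+ T) :+ M) :- M) refl r t M ⟩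
  ((r ℤ.+ t) ℤ.+ M) ℤ.- M    ≤⟨ ℤ.+-monoˡ-≤ (ℤ.- M) sum ⟩
  (d ℤ.+ M) ℤ.- M            ≡⟨ solve 2 (λ D M → (D :+ M) :- M := D) refl d M ⟩
  d                          ∎)
  where
  open ℤ.≤-Reasoning
  open ℤ-Solver.+-*-Solver
  p = ↥ P ; r = ↧ P ; s = ↥ S ; t = ↧ S ; c = ↥ δ ; d = ↧ δ
  M = t ℤ.* (p ℤ.* d) ℤ.+ r ℤ.* (c ℤ.* t)
  sum : (r ℤ.+ t) ℤ.+ M ℤ.≤ d ℤ.+ M
  sum = begin
    (r ℤ.+ t) ℤ.+ M
      ≡⟨ solve 5 (λ P R T C D → (R :+ T) :+ (T :* (P :* D) :+ R :* (C :* T))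
                               := T :* (con (+ 1) :+ P :* D) :+ R :* (con (+ 1) :+ C :* T)) refl p r t c d ⟩
    t ℤ.* ℤ.suc (p ℤ.* d) ℤ.+ r ℤ.* ℤ.suc (c ℤ.* t)
      ≤⟨ ℤ.+-mono-≤ (ℤ.*-monoˡ-≤-nonNeg t (ℤ.i<j⇒suc[i]≤j pd<cr)) (ℤ.*-monoˡ-≤-nonNeg r (ℤ.i<j⇒suc[i]≤j ct<sd)) ⟩
    t ℤ.* (c ℤ.* r) ℤ.+ r ℤ.* (s ℤ.* d)
      ≡⟨ solve 6 (λ P R S T C D → T :* (C :* R) :+ R :* (S :* D)
                                 := D :* (S :* R :- P :* T) :+ (T :* (P :* D) :+ R :* (C :* T))) refl p r s t c d ⟩
    d ℤ.* (s ℤ.* r ℤ.- p ℤ.* t) ℤ.+ M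
      ≡⟨ cong (λ z → d ℤ.* z ℤ.+ M) det ⟩
    d ℤ.* + 1 ℤ.+ M
      ≡⟨ cong (ℤ._+ M) (ℤ.*-identityʳ d) ⟩
    d ℤ.+ M
      ∎

adjacent-betweenˡ : ∀ {P S δ} → Adjacent P S → P < δ → δ < S → ↧ₙ P ℕ.< ↧ₙ δ
adjacent-betweenˡ {P} adj P<δ δ<S = ℕ.<-≤-trans (ℕ.m<m+n (↧ₙ P) ℕ.z<s) (adjacent-gap adj P<δ δ<S)

adjacent-betweenʳ : ∀ {P S δ} → Adjacent P S → P < δ → δ < S → ↧ₙ S ℕ.< ↧ₙ δ
adjacent-betweenʳ {S = S} adj P<δ δ<S = ℕ.<-≤-trans (ℕ.m<n+m (↧ₙ S) ℕ.z<s) (adjacent-gap adj P<δ δ<S)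

det⇒coprime : ∀ {m n k l} → m ℕ.* n ≡ suc (k ℕ.* l) → Coprime m l × Coprime k n
det⇒coprime {m} {n} {k} {l} mn≡1+kl =
  (λ (d∣m , d∣l) → divides-1 (∣-trans d∣m (m∣m*n n)) (∣-trans d∣l (n∣m*n k))) ,
  (λ (d∣k , d∣n) → divides-1 (∣-trans d∣n (n∣m*n m)) (∣-trans d∣k (m∣m*n l)))
  where
  divides-1 : ∀ {d} → d ∣ m ℕ.* n → d ∣ k ℕ.* l → d ≡ 1
  divides-1 {d} d∣mn d∣kl = ∣1⇒≡1 (∣m+n∣m⇒∣n (subst (d ∣_) (trans mn≡1+kl (ℕ.+-comm 1 (k ℕ.* l))) d∣mn) d∣kl)

ℤ-det≡1 : ∀ m n k l → m ℕ.* n ≡ suc (k ℕ.* l) → + m ℤ.* + n ℤ.- + k ℤ.* + l ≡ + 1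
ℤ-det≡1 m n k l mn≡1+kl = begin
  + m ℤ.* + n ℤ.- + k ℤ.* + l           ≡⟨ cong₂ ℤ._-_ (ℤ.pos-* m n) (ℤ.pos-* k l) ⟨
  + (m ℕ.* n) ℤ.- + (k ℕ.* l)           ≡⟨ cong (λ z → + z ℤ.- + (k ℕ.* l)) mn≡1+kl ⟩
  + 1 ℤ.+ + (k ℕ.* l) ℤ.- + (k ℕ.* l)   ≡⟨ solve 1 (λ z → con (+ 1) :+ z :- z := con (+ 1)) refl (+ (k ℕ.* l)) ⟩
  + 1                                   ∎
  where
  open ≡-Reasoning
  open ℤ-Solver.+-*-Solver

-- Bézout may only give x a ≡ -1 (mod q); then (x a)² ≡ 1, so x (x a) is an inverse of a.
unreduced-inverse : ∀ {a q} → 1 ℕ.< q → Coprime a q → ∃₂ λ x k → a ℕ.* x ≡ suc (k ℕ.* q)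
unreduced-inverse {a} {q} 1<q a⊥q with coprime-Bézout a⊥q
... | Bézout.+- x k 1+kq≡xa = x , k , trans (ℕ.*-comm a x) (sym 1+kq≡xa)
... | Bézout.-+ x y 1+xa≡yq with x ℕ.* a in xa≡w
...   | zero  = ⊥-elim (ℕ.<-irrefl (sym (ℕ.m*n≡1⇒n≡1 y q (sym 1+xa≡yq))) 1<q)
...   | suc w = x ℕ.* suc w , w ℕ.* y , (begin
  a ℕ.* (x ℕ.* suc w)       ≡⟨ solve 3 (λ a x v → a :* (x :* v) := (x :* a) :* v) refl a x (suc w) ⟩
  (x ℕ.* a) ℕ.* suc w       ≡⟨ cong (ℕ._* suc w) xa≡w ⟩
  suc w ℕ.* suc w           ≡⟨ solve 1 (λ w → (con 1 :+ w) :* (con 1 :+ w) := con 1 :+ w :* (con 2 :+ w)) refl w ⟩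
  suc (w ℕ.* suc (suc w))   ≡⟨ cong (λ z → suc (w ℕ.* z)) 1+xa≡yq ⟩
  suc (w ℕ.* (y ℕ.* q))     ≡⟨ cong suc (ℕ.*-assoc w y q) ⟨
  suc (w ℕ.* y ℕ.* q)       ∎)
  where
  open ≡-Reasoning
  open ℕ-Solver.+-*-Solver

modular-inverse : ∀ {a q} .{{_ : NonZero q}} → 1 ℕ.< q → Coprime a q →
                  ∃₂ λ q′ a′ → 0 ℕ.< q′ × q′ ℕ.< q × a ℕ.* q′ ≡ suc (a′ ℕ.* q)
modular-inverse {a} {q} 1<q a⊥q with unreduced-inverse 1<q a⊥q
... | x , k , ax≡1+kq = q′ , a′ , ℕ.n≢0⇒n>0 q′≢0 , m%n<n x q , aq′≡1+a′q
  where
  open ≡-Reasoning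
  q′ = x % q
  a′ = a ℕ.* q′ / q
  aq′%q≡1 : a ℕ.* q′ % q ≡ 1
  aq′%q≡1 = begin
    a ℕ.* (x % q) % q              ≡⟨ %-distribˡ-* a (x % q) q ⟩
    (a % q) ℕ.* (x % q % q) % q    ≡⟨ cong (λ z → (a % q) ℕ.* z % q) (m%n%n≡m%n x q) ⟩
    (a % q) ℕ.* (x % q) % q        ≡⟨ %-distribˡ-* a x q ⟨
    a ℕ.* x % q                    ≡⟨ cong (_% q) ax≡1+kq ⟩
    (1 ℕ.+ k ℕ.* q) % q            ≡⟨ [m+kn]%n≡m%n 1 k q ⟩
    1 % q                          ≡⟨ m<n⇒m%n≡m 1<q ⟩
    1                              ∎
  aq′≡1+a′q : a ℕ.* q′ ≡ suc (a′ ℕ.* q)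
  aq′≡1+a′q = trans (m≡m%n+[m/n]*n (a ℕ.* q′) q) (cong (ℕ._+ a′ ℕ.* q) aq′%q≡1)
  q′≢0 : q′ ≢ 0
  q′≢0 q′≡0 = ℕ.0≢1+n (trans (sym (trans (cong (a ℕ.*_) q′≡0) (ℕ.*-zeroʳ a))) aq′≡1+a′q)

mediant-complement : ∀ {a q q′ a′} → a ℕ.* q′ ≡ suc (a′ ℕ.* q) → q′ ℕ.< q →
                     ∃₂ λ c r → 0 ℕ.< r × q′ ℕ.+ r ≡ q × c ℕ.* q ≡ suc (a ℕ.* r)
mediant-complement {a} {q} {q′} {a′} aq′≡1+a′q q′<q = c , r , ℕ.m<n⇒0<n∸m q′<q , q′+r≡q , cq≡1+ar
  where
  a′<a : a′ ℕ.< a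
  a′<a = ℕ.*-cancelʳ-< q a′ a (begin-strict
    a′ ℕ.* q         <⟨ ℕ.n<1+n _ ⟩
    suc (a′ ℕ.* q)   ≡⟨ aq′≡1+a′q ⟨
    a ℕ.* q′         ≤⟨ ℕ.*-monoʳ-≤ a (ℕ.<⇒≤ q′<q) ⟩
    a ℕ.* q          ∎)
    where open ℕ.≤-Reasoning
  c = a ℕ.∸ a′
  r = q ℕ.∸ q′
  a′+c≡a : a′ ℕ.+ c ≡ a
  a′+c≡a = ℕ.m+[n∸m]≡n (ℕ.<⇒≤ a′<a)
  q′+r≡q : q′ ℕ.+ r ≡ q
  q′+r≡q = ℕ.m+[n∸m]≡n (ℕ.<⇒≤ q′<q)
  cq≡1+ar : c ℕ.* q ≡ suc (a ℕ.* r)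
  cq≡1+ar = ℕ.+-cancelˡ-≡ (a′ ℕ.* q) _ _ (begin
    a′ ℕ.* q ℕ.+ c ℕ.* q         ≡⟨ ℕ.*-distribʳ-+ q a′ c ⟨
    (a′ ℕ.+ c) ℕ.* q             ≡⟨ cong (ℕ._* q) a′+c≡a ⟩
    a ℕ.* q                      ≡⟨ cong (a ℕ.*_) q′+r≡q ⟨
    a ℕ.* (q′ ℕ.+ r)             ≡⟨ ℕ.*-distribˡ-+ a q′ r ⟩
    a ℕ.* q′ ℕ.+ a ℕ.* r         ≡⟨ cong (ℕ._+ a ℕ.* r) aq′≡1+a′q ⟩
    suc (a′ ℕ.* q) ℕ.+ a ℕ.* r   ≡⟨ ℕ.+-suc (a′ ℕ.* q) (a ℕ.* r) ⟨
    a′ ℕ.* q ℕ.+ suc (a ℕ.* r)   ∎)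
    where open ≡-Reasoning

leftNbr-of-adjacent : ∀ {β L} → InUnit β → 0ℚ ≤ L → Adjacent L β → height L ℕ.≤ height β → IsLeftNbr β L
leftNbr-of-adjacent {β} {L} (_ , β<1) 0≤L adj hL≤hβ =
  (0≤L , ℚ.<-trans L<β β<1) , hL≤hβ , <⇒≢ L<β , nothing-between
  where
  L<β = adjacent⇒< adj
  nothing-between : ∀ δ → InUnit δ → height δ ℕ.≤ height β → ¬ InArc L β δ
  nothing-between δ _ hδ≤hβ (inj₁ (_ , L<δ , δ<β)) = ℕ.<⇒≱ (adjacent-betweenʳ adj L<δ δ<β) hδ≤hβ
  nothing-between δ _ _     (inj₂ (β<L , _))       = ℚ.<-asym L<β β<L

rightNbr-of-adjacent : ∀ {β R} → InUnit β → Adjacent β R → R < 1ℚ → height R ℕ.≤ height β → IsRightNbr β R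
rightNbr-of-adjacent {β} {R} (0≤β , _) adj R<1 hR≤hβ =
  (ℚ.<⇒≤ (ℚ.≤-<-trans 0≤β β<R) , R<1) , hR≤hβ , (λ R≡β → <⇒≢ β<R (sym R≡β)) , nothing-between
  where
  β<R = adjacent⇒< adj
  nothing-between : ∀ δ → InUnit δ → height δ ℕ.≤ height β → ¬ InArc β R δ
  nothing-between δ _ hδ≤hβ (inj₁ (_ , β<δ , δ<R)) = ℕ.<⇒≱ (adjacent-betweenˡ adj β<δ δ<R) hδ≤hβ
  nothing-between δ _ _     (inj₂ (R<β , _))       = ℚ.<-asym β<R R<β

-- The arc from β to 0 ≡ 1 (mod 1) is the interval (β, 1).
rightNbr-of-adjacent-to-1 : ∀ {β} → InUnit β → β ≢ 0ℚ → Adjacent β 1ℚ → IsRightNbr β 0ℚ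
rightNbr-of-adjacent-to-1 {β} (0≤β , _) β≢0 adj =
  (ℚ.≤-refl , 0<1) , s≤s z≤n , (λ 0≡β → β≢0 (sym 0≡β)) , nothing-between
  where
  nothing-between : ∀ δ → InUnit δ → height δ ℕ.≤ height β → ¬ InArc β 0ℚ δ
  nothing-between δ _         _     (inj₁ (β<0 , _))      = ℚ.<-irrefl refl (ℚ.<-≤-trans β<0 0≤β)
  nothing-between δ (_ , δ<1) hδ≤hβ (inj₂ (_ , inj₁ β<δ)) = ℕ.<⇒≱ (adjacent-betweenˡ adj β<δ δ<1) hδ≤hβ
  nothing-between δ (0≤δ , _) _     (inj₂ (_ , inj₂ δ<0)) = ℚ.<-irrefl refl (ℚ.<-≤-trans δ<0 0≤δ)

record Neighbours (β : ℚ) : Set where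
  field
    left right : ℚ
    isLeft     : IsLeftNbr β left
    isRight    : IsRightNbr β right
    heights    : height left ℕ.+ height right ≡ height β

-- β = a/q with a q′ = 1 + a′ q and c q = 1 + a r, q = q′ + r; its neighbours are a′/q′ and c/r (mod 1).
module _ (a d q′₋₁ a′ c r₋₁ : ℕ) .{a⊥q : Coprime a (suc d)}
         (β∈ : InUnit (mkℚ (+ a) d a⊥q)) (β≢0 : mkℚ (+ a) d a⊥q ≢ 0ℚ)
         (aq′≡1+a′q : a ℕ.* suc q′₋₁ ≡ suc (a′ ℕ.* suc d))
         (cq≡1+ar : c ℕ.* suc d ≡ suc (a ℕ.* suc r₋₁))
         (q′+r≡q : suc q′₋₁ ℕ.+ suc r₋₁ ≡ suc d) where

  private
    β L R̂ : ℚ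
    β = mkℚ (+ a) d a⊥q
    L = mkℚ (+ a′) q′₋₁ (proj₂ (det⇒coprime {m = a} aq′≡1+a′q))
    R̂ = mkℚ (+ c) r₋₁ (proj₁ (det⇒coprime {k = a} cq≡1+ar))

    L∼β : Adjacent L β
    L∼β = ℤ-det≡1 a (suc q′₋₁) a′ (suc d) aq′≡1+a′q

    β∼R̂ : Adjacent β R̂
    β∼R̂ = ℤ-det≡1 c (suc d) a (suc r₋₁) cq≡1+ar

    isLeft : IsLeftNbr β L
    isLeft = leftNbr-of-adjacent β∈ (ℚ.nonNegative⁻¹ L) L∼β
               (subst (suc q′₋₁ ℕ.≤_) q′+r≡q (ℕ.m≤m+n (suc q′₋₁) (suc r₋₁)))

    R̂≤1 : R̂ ≤ 1ℚ
    R̂≤1 = ℚ.≮⇒≥ (λ 1<R̂ → ℕ.n≮0 (ℕ.≤-pred (adjacent-betweenˡ β∼R̂ (proj₂ β∈) 1<R̂)))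

  neighbours-from-det : Neighbours β
  neighbours-from-det with R̂ <? 1ℚ
  ... | yes R̂<1 = record
    { left = L ; right = R̂ ; isLeft = isLeft
    ; isRight = rightNbr-of-adjacent β∈ β∼R̂ R̂<1 (subst (suc r₋₁ ℕ.≤_) q′+r≡q (ℕ.m≤n+m (suc r₋₁) (suc q′₋₁)))
    ; heights = q′+r≡q }
  ... | no R̂≮1 = record
    { left = L ; right = 0ℚ ; isLeft = isLeft
    ; isRight = rightNbr-of-adjacent-to-1 β∈ β≢0 (subst (Adjacent β) R̂≡1 β∼R̂)
    ; heights = trans (cong (suc q′₋₁ ℕ.+_) (sym (cong ↧ₙ_ R̂≡1))) q′+r≡q }
    where
    R̂≡1 : R̂ ≡ 1ℚ
    R̂≡1 = ℚ.≤-antisym R̂≤1 (ℚ.≮⇒≥ R̂≮1)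

neighbours : ∀ {β} → InUnit β → β ≢ 0ℚ → Neighbours β
neighbours {β@(mkℚ -[1+ _ ] _ _)} (0≤β , _) _ = ⊥-elim (ℚ.<-irrefl refl (ℚ.<-≤-trans (ℚ.negative⁻¹ β) 0≤β))
neighbours {β@(mkℚ (+ a) d a⊥q)} β∈@(0≤β , β<1) β≢0 = from-inverse (modular-inverse 1<q (Coprime.recompute a⊥q))
  where
  q = suc d
  1<q : 1 ℕ.< q
  1<q = ℕ.<-≤-trans (s≤s (0<mkℚ⇒0<n (≤∧≢⇒< 0≤β (λ 0≡β → β≢0 (sym 0≡β))))) (mkℚ<1⇒n<1+d β<1)
  from-inverse : (∃₂ λ q′ a′ → 0 ℕ.< q′ × q′ ℕ.< q × a ℕ.* q′ ≡ suc (a′ ℕ.* q)) → Neighbours β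
  from-inverse (zero , _ , () , _)
  from-inverse (suc q′₋₁ , a′ , _ , q′<q , aq′≡1+a′q) =
    from-complement (mediant-complement {a} {q} {suc q′₋₁} {a′} aq′≡1+a′q q′<q)
    where
    from-complement : (∃₂ λ c r → 0 ℕ.< r × suc q′₋₁ ℕ.+ r ≡ q × c ℕ.* q ≡ suc (a ℕ.* r)) → Neighbours β
    from-complement (_ , zero , () , _)
    from-complement (c , suc r₋₁ , _ , q′+r≡q , cq≡1+ar) =
      neighbours-from-det a d q′₋₁ a′ c r₋₁ β∈ β≢0 aq′≡1+a′q cq≡1+ar q′+r≡q

InArc-rotate : ∀ {a b x} → InArc a b x → InArc x a b
InArc-rotate (inj₁ (_ , a<x , x<b))  = inj₂ (a<x , inj₁ x<b)
InArc-rotate (inj₂ (b<a , inj₁ a<x)) = inj₂ (a<x , inj₂ b<a)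
InArc-rotate (inj₂ (b<a , inj₂ x<b)) = inj₁ (ℚ.<-trans x<b b<a , x<b , b<a)

InArc-connex : ∀ {g h b} → g ≢ h → g ≢ b → h ≢ b → InArc g b h ⊎ InArc h b g
InArc-connex g≢h g≢b h≢b with <-connex g≢b | <-connex h≢b | <-connex g≢h
... | inj₁ g<b | inj₁ h<b | inj₁ g<h = inj₁ (inj₁ (g<b , g<h , h<b))
... | inj₁ g<b | inj₁ h<b | inj₂ h<g = inj₂ (inj₁ (h<b , h<g , g<b))
... | inj₁ g<b | inj₂ b<h | _        = inj₂ (inj₂ (b<h , inj₂ g<b))
... | inj₂ b<g | inj₁ h<b | _        = inj₁ (inj₂ (b<g , inj₂ h<b))
... | inj₂ b<g | inj₂ b<h | inj₁ g<h = inj₁ (inj₂ (b<g , inj₁ g<h))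
... | inj₂ b<g | inj₂ b<h | inj₂ h<g = inj₂ (inj₂ (b<h , inj₁ h<g))

leftNbr-unique : ∀ {β γ δ} → IsLeftNbr β γ → IsLeftNbr β δ → γ ≡ δ
leftNbr-unique {γ = γ} {δ} (γ∈ , hγ , γ≢β , γ-alone) (δ∈ , hδ , δ≢β , δ-alone) with γ ℚ.≟ δ
... | yes γ≡δ = γ≡δ
... | no γ≢δ with InArc-connex γ≢δ γ≢β δ≢β
...   | inj₁ δ∈I[γ,β] = ⊥-elim (γ-alone δ δ∈ hδ δ∈I[γ,β])
...   | inj₂ γ∈I[δ,β] = ⊥-elim (δ-alone γ γ∈ hγ γ∈I[δ,β])

rightNbr-unique : ∀ {β γ δ} → IsRightNbr β γ → IsRightNbr β δ → γ ≡ δ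
rightNbr-unique {γ = γ} {δ} (γ∈ , hγ , γ≢β , γ-alone) (δ∈ , hδ , δ≢β , δ-alone) with γ ℚ.≟ δ
... | yes γ≡δ = γ≡δ
... | no γ≢δ with InArc-connex γ≢δ γ≢β δ≢β
...   | inj₁ δ∈I[γ,β] = ⊥-elim (δ-alone γ γ∈ hγ (InArc-rotate (InArc-rotate δ∈I[γ,β])))
...   | inj₂ γ∈I[δ,β] = ⊥-elim (γ-alone δ δ∈ hδ (InArc-rotate (InArc-rotate γ∈I[δ,β])))

neighbour-heights : ∀ {β L R} → InUnit β → β ≢ 0ℚ → IsLeftNbr β L → IsRightNbr β R →
                    height L ℕ.+ height R ≡ height β
neighbour-heights {β} β∈ β≢0 isL isR =
  subst₂ (λ L R → height L ℕ.+ height R ≡ height β) (leftNbr-unique isLeft isL) (rightNbr-unique isRight isR) heights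
  where open Neighbours (neighbours β∈ β≢0)

ι≡mkℚ : ∀ n → ι n ≡ mkℚ (+ n) 0 (Coprime.sym (Coprime.1-coprimeTo n))
ι≡mkℚ n = ℚ.normalize-coprime (Coprime.sym (Coprime.1-coprimeTo n))

ι-+ : ∀ m n → ι (m ℕ.+ n) ≡ ι m + ι n
ι-+ m n rewrite ι≡mkℚ m | ι≡mkℚ n | ℤ.*-identityʳ (+ m) | ℤ.*-identityʳ (+ n) = refl

ι-height≢0 : ∀ r → ι (height r) ≢ 0ℚ
ι-height≢0 r ιh≡0 with trans (sym (ι≡mkℚ (height r))) ιh≡0
... | ()

-- Windows around a point

Outside : ℚ → ℚ → ℚ → Set
Outside x y p = p < x ⊎ y < p

outside-mono : ∀ {x y x′ y′ p} → x ≤ x′ → y′ ≤ y → Outside x y p → Outside x′ y′ p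
outside-mono x≤x′ _    (inj₁ p<x) = inj₁ (ℚ.<-≤-trans p<x x≤x′)
outside-mono _    y′≤y (inj₂ y<p) = inj₂ (ℚ.≤-<-trans y′≤y y<p)

record Window (γ : ℚ) (ps : List ℚ) : Set where
  constructor mkWindow
  field
    x y   : ℚ
    x∈    : InUnit x
    y∈    : InUnit y
    x<γ   : x < γ
    γ<y   : γ < y
    clear : All (λ p → p ≡ γ ⊎ Outside x y p) ps

shrink : ∀ {γ ps} (w : Window γ ps) {x′ y′} → Window.x w ≤ x′ → x′ < γ → γ < y′ → y′ ≤ Window.y w → Window γ ps
shrink (mkWindow x y (0≤x , _) (_ , y<1) _ _ clear) {x′} {y′} x≤x′ x′<γ γ<y′ y′≤y =
  mkWindow x′ y′ (0≤x′ , ℚ.<-trans x′<y′ y′<1) (ℚ.<⇒≤ (ℚ.≤-<-trans 0≤x′ x′<y′) , y′<1) x′<γ γ<y′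
           (All.map (Sum.map₂ (outside-mono x≤x′ y′≤y)) clear)
  where
  0≤x′  = ℚ.≤-trans 0≤x x≤x′
  x′<y′ = ℚ.<-trans x′<γ γ<y′
  y′<1  = ℚ.≤-<-trans y′≤y y<1

extend : ∀ {γ ps p} (w : Window γ ps) → p ≡ γ ⊎ Outside (Window.x w) (Window.y w) p → Window γ (p ∷ ps)
extend (mkWindow x y x∈ y∈ x<γ γ<y clear) c = mkWindow x y x∈ y∈ x<γ γ<y (c ∷ clear)

⊔-< : ∀ {p q r} → p < r → q < r → p ⊔ q < r
⊔-< {p} {q} p<r q<r = [ (λ p⊔q≡p → subst (_< _) (sym p⊔q≡p) p<r) , (λ p⊔q≡q → subst (_< _) (sym p⊔q≡q) q<r) ]′
                      (ℚ.⊔-sel p q)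

<-⊓ : ∀ {p q r} → r < p → r < q → r < p ⊓ q
<-⊓ {p} {q} r<p r<q = [ (λ p⊓q≡p → subst (_ <_) (sym p⊓q≡p) r<p) , (λ p⊓q≡q → subst (_ <_) (sym p⊓q≡q) r<q) ]′
                      (ℚ.⊓-sel p q)

narrow : ∀ {γ ps} → Window γ ps → ∀ p → Window γ (p ∷ ps)
narrow {γ} w p with p ℚ.≟ γ
... | yes p≡γ = extend w (inj₁ p≡γ)
... | no p≢γ with <-connex p≢γ
...   | inj₁ p<γ with ℚ.<-dense (⊔-< (Window.x<γ w) p<γ)
...     | x′ , x⊔p<x′ , x′<γ = extend w′ (inj₂ (inj₁ (ℚ.≤-<-trans (ℚ.p≤q⊔p (Window.x w) p) x⊔p<x′)))
  where w′ = shrink w (ℚ.<⇒≤ (ℚ.≤-<-trans (ℚ.p≤p⊔q (Window.x w) p) x⊔p<x′)) x′<γ (Window.γ<y w) ℚ.≤-refl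
narrow {γ} w p | no p≢γ | inj₂ γ<p with ℚ.<-dense (<-⊓ (Window.γ<y w) γ<p)
...     | y′ , γ<y′ , y′<y⊓p = extend w′ (inj₂ (inj₂ (ℚ.<-≤-trans y′<y⊓p (ℚ.p⊓q≤q (Window.y w) p))))
  where w′ = shrink w ℚ.≤-refl (Window.x<γ w) γ<y′ (ℚ.<⇒≤ (ℚ.<-≤-trans y′<y⊓p (ℚ.p⊓q≤p (Window.y w) p)))

window : ∀ {γ} → 0ℚ < γ → γ < 1ℚ → ∀ ps → Window γ ps
window 0<γ γ<1 [] with ℚ.<-dense 0<γ | ℚ.<-dense γ<1
... | x , 0<x , x<γ | y , γ<y , y<1 =
  mkWindow x y (ℚ.<⇒≤ 0<x , ℚ.<-trans x<γ γ<1) (ℚ.<⇒≤ (ℚ.<-trans 0<γ γ<y) , y<1) x<γ γ<y []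
window 0<γ γ<1 (p ∷ ps) = narrow (window 0<γ γ<1 ps) p

SameSide : ℚ → ℚ → ℚ → Set
SameSide x y γ = (x < γ → y < γ) × (y < γ → x < γ)

Unseparated : ℚ → ℚ → ℚ → Set
Unseparated x y p = x ≢ p × y ≢ p × SameSide x y p

outside⇒unseparated : ∀ {x y p} → x < y → Outside x y p → Unseparated x y p
outside⇒unseparated x<y (inj₁ p<x) =
  <⇒≢ p<x ∘ sym , <⇒≢ (ℚ.<-trans p<x x<y) ∘ sym ,
  (λ x<p → ⊥-elim (ℚ.<-asym p<x x<p)) , (λ y<p → ⊥-elim (ℚ.<-asym (ℚ.<-trans p<x x<y) y<p))
outside⇒unseparated x<y (inj₂ y<p) =
  <⇒≢ (ℚ.<-trans x<y y<p) , <⇒≢ y<p , (λ _ → y<p) , (λ _ → ℚ.<-trans x<y y<p)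

unseparated⇒≢ : ∀ {x y γ p} → x < γ → γ < y → Unseparated x y p → p ≢ γ
unseparated⇒≢ x<γ γ<y (_ , _ , x<p⇒y<p , _) refl = ℚ.<-asym γ<y (x<p⇒y<p x<γ)

below-cong : ∀ {x y γ} → SameSide x y γ → below x γ ≡ below y γ
below-cong {x} {y} {γ} (x<γ⇒y<γ , y<γ⇒x<γ) with x <? γ | y <? γ
... | yes _   | yes _   = refl
... | no _    | no _    = refl
... | yes x<γ | no y≮γ  = ⊥-elim (y≮γ (x<γ⇒y<γ x<γ))
... | no x≮γ  | yes y<γ = ⊥-elim (x≮γ (y<γ⇒x<γ y<γ))

below-jump : ∀ {x y γ} → x < γ → γ < y → below x γ ≡ below y γ + 1ℚ
below-jump {x} {y} {γ} x<γ γ<y with x <? γ | y <? γ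
... | yes _  | no _    = sym (ℚ.+-identityˡ 1ℚ)
... | no x≮γ | _       = ⊥-elim (x≮γ x<γ)
... | yes _  | yes y<γ = ⊥-elim (ℚ.<-asym γ<y y<γ)

Crossing : ℚ → ℚ → ℚ → ℚ → Set
Crossing x y p d = x ≢ p × y ≢ p × below x p ≡ below y p + d

crossing : ∀ {x y γ p} → x < γ → γ < y → p ≡ γ → Crossing x y p 1ℚ
crossing x<γ γ<y refl = <⇒≢ x<γ , (λ y≡γ → <⇒≢ γ<y (sym y≡γ)) , below-jump x<γ γ<y

not-crossing : ∀ {x y p} → Unseparated x y p → Crossing x y p 0ℚ
not-crossing (x≢p , y≢p , s) = x≢p , y≢p , trans (below-cong s) (sym (ℚ.+-identityʳ _))

-- The function f_β

module Sawtooth {β L R : ℚ} (β∈ : InUnit β) (β≢0 : β ≢ 0ℚ) (isL : IsLeftNbr β L) (isR : IsRightNbr β R) where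

  open +-*-Solver

  h h′ h″ : ℚ
  h  = ι (height β)
  h′ = ι (height L)
  h″ = ι (height R)

  h′+h″≡h : h′ + h″ ≡ h
  h′+h″≡h = trans (sym (ι-+ (height L) (height R))) (cong ι (neighbour-heights β∈ β≢0 isL isR))

  steps : ℚ → ℚ
  steps x = (h * below x β - h′ * below x L) - h″ * below x R

  offset : ℚ
  offset = (h′ * L + h″ * R) - h * β

  fβ≡offset+steps : ∀ {x} → InUnit x → x ≢ β → x ≢ L → x ≢ R → fβ β L R x ≡ offset + steps x
  fβ≡offset+steps {x} x∈ x≢β x≢L x≢R = begin
    fβ β L R x
      ≡⟨ cong₂ _-_ (cong₂ _-_ (cong (h *_) (ψ[x-γ]≡x-γ-½+below x∈ β∈ x≢β))
                              (cong (h′ *_) (ψ[x-γ]≡x-γ-½+below x∈ (proj₁ isL) x≢L)))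
                   (cong (h″ *_) (ψ[x-γ]≡x-γ-½+below x∈ (proj₁ isR) x≢R)) ⟩
    (h * (((x - β) - ½) + below x β) - h′ * (((x - L) - ½) + below x L)) - h″ * (((x - R) - ½) + below x R)
      ≡⟨ regroup (sym h′+h″≡h) ⟩
    offset + steps x
      ∎
    where
    open ≡-Reasoning
    regroup : ∀ {H} → H ≡ h′ + h″ →
              (H * (((x - β) - ½) + below x β) - h′ * (((x - L) - ½) + below x L)) - h″ * (((x - R) - ½) + below x R)
              ≡ ((h′ * L + h″ * R) - H * β) + ((H * below x β - h′ * below x L) - h″ * below x R)
    regroup refl = solve 9 (λ a b x β L R u v w →
      ((a :+ b) :* (((x :- β) :- con ½) :+ u) :- a :* (((x :- L) :- con ½) :+ v)) :- b :* (((x :- R) :- con ½) :+ w)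
      := ((a :* L :+ b :* R) :- (a :+ b) :* β) :+ (((a :+ b) :* u :- a :* v) :- b :* w))
      refl h′ h″ x β L R (below x β) (below x L) (below x R)

  fβ-cong : ∀ {x y} → InUnit x → InUnit y → Unseparated x y β → Unseparated x y L → Unseparated x y R →
            fβ β L R x ≡ fβ β L R y
  fβ-cong {x} {y} x∈ y∈ (x≢β , y≢β , sβ) (x≢L , y≢L , sL) (x≢R , y≢R , sR) = begin
    fβ β L R x          ≡⟨ fβ≡offset+steps x∈ x≢β x≢L x≢R ⟩
    offset + steps x    ≡⟨ cong (λ s → offset + s) steps-x≡steps-y ⟩
    offset + steps y    ≡⟨ fβ≡offset+steps y∈ y≢β y≢L y≢R ⟨
    fβ β L R y          ∎
    where
    open ≡-Reasoning
    steps-x≡steps-y : steps x ≡ steps y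
    steps-x≡steps-y = cong₂ _-_ (cong₂ _-_ (cong (h *_) (below-cong sβ)) (cong (h′ *_) (below-cong sL)))
                                (cong (h″ *_) (below-cong sR))

  steps-jump : ∀ {x y d₁ d₂ d₃} → below x β ≡ below y β + d₁ → below x L ≡ below y L + d₂ → below x R ≡ below y R + d₃ →
               steps x ≡ steps y + ((h * d₁ - h′ * d₂) - h″ * d₃)
  steps-jump {x} {y} {d₁} {d₂} {d₃} jβ jL jR = begin
    steps x
      ≡⟨ cong₂ _-_ (cong₂ _-_ (cong (h *_) jβ) (cong (h′ *_) jL)) (cong (h″ *_) jR) ⟩
    (h * (below y β + d₁) - h′ * (below y L + d₂)) - h″ * (below y R + d₃)
      ≡⟨ solve 9 (λ a b c u v w d e f → (a :* (u :+ d) :- b :* (v :+ e)) :- c :* (w :+ f)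
                                       := ((a :* u :- b :* v) :- c :* w) :+ ((a :* d :- b :* e) :- c :* f))
           refl h h′ h″ (below y β) (below y L) (below y R) d₁ d₂ d₃ ⟩
    steps y + ((h * d₁ - h′ * d₂) - h″ * d₃)
      ∎
    where open ≡-Reasoning

  fβ-jump : ∀ {x y d₁ d₂ d₃} → InUnit x → InUnit y → Crossing x y β d₁ → Crossing x y L d₂ → Crossing x y R d₃ →
            fβ β L R x ≡ fβ β L R y → (h * d₁ - h′ * d₂) - h″ * d₃ ≡ 0ℚ
  fβ-jump {x} {y} x∈ y∈ (x≢β , y≢β , jβ) (x≢L , y≢L , jL) (x≢R , y≢R , jR) fx≡fy =
    identityʳ-unique (steps y) _ (trans (sym (steps-jump {x} {y} jβ jL jR)) steps-x≡steps-y)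
    where
    steps-x≡steps-y : steps x ≡ steps y
    steps-x≡steps-y = ∙-cancelˡ offset (steps x) (steps y)
      (trans (sym (fβ≡offset+steps x∈ x≢β x≢L x≢R)) (trans fx≡fy (fβ≡offset+steps y∈ y≢β y≢L y≢R)))

  module _ {γ ps} (w : Window γ (β ∷ L ∷ R ∷ ps)) where

    open Window w

    private
      neg≡0⇒≡0 : ∀ {q} → - q ≡ 0ℚ → q ≡ 0ℚ
      neg≡0⇒≡0 {q} = ℚ.neg-injective {q} {0ℚ}

      crossing-γ : ∀ {p} → p ≡ γ → Crossing x y p 1ℚ
      crossing-γ = crossing x<γ γ<y

      -- Crossing exactly those of β, L, R equal to γ changes f_β by h, -h′, -h″ or -(h′ + h″), never by 0.
      no-crossing : fβ β L R x ≡ fβ β L R y →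
                    β ≡ γ ⊎ Unseparated x y β → L ≡ γ ⊎ Unseparated x y L → R ≡ γ ⊎ Unseparated x y R →
                    β ≢ γ × L ≢ γ × R ≢ γ
      no-crossing _ (inj₂ uβ) (inj₂ uL) (inj₂ uR) =
        unseparated⇒≢ x<γ γ<y uβ , unseparated⇒≢ x<γ γ<y uL , unseparated⇒≢ x<γ γ<y uR
      no-crossing _ (inj₁ refl) (inj₁ L≡β) _ = ⊥-elim (proj₁ (proj₂ (proj₂ isL)) L≡β)
      no-crossing _ (inj₁ refl) _ (inj₁ R≡β) = ⊥-elim (proj₁ (proj₂ (proj₂ isR)) R≡β)
      no-crossing fx≡fy (inj₁ β≡γ) (inj₂ uL) (inj₂ uR) = ⊥-elim (ι-height≢0 β (trans
        (solve 3 (λ a b c → a := (a :* con 1ℚ :- b :* con 0ℚ) :- c :* con 0ℚ) refl h h′ h″)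
        (fβ-jump x∈ y∈ (crossing-γ β≡γ) (not-crossing uL) (not-crossing uR) fx≡fy)))
      no-crossing fx≡fy (inj₂ uβ) (inj₁ L≡γ) (inj₂ uR) = ⊥-elim (ι-height≢0 L (neg≡0⇒≡0 (trans
        (solve 3 (λ a b c → :- b := (a :* con 0ℚ :- b :* con 1ℚ) :- c :* con 0ℚ) refl h h′ h″)
        (fβ-jump x∈ y∈ (not-crossing uβ) (crossing-γ L≡γ) (not-crossing uR) fx≡fy))))
      no-crossing fx≡fy (inj₂ uβ) (inj₂ uL) (inj₁ R≡γ) = ⊥-elim (ι-height≢0 R (neg≡0⇒≡0 (trans
        (solve 3 (λ a b c → :- c := (a :* con 0ℚ :- b :* con 0ℚ) :- c :* con 1ℚ) refl h h′ h″)
        (fβ-jump x∈ y∈ (not-crossing uβ) (not-crossing uL) (crossing-γ R≡γ) fx≡fy))))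
      no-crossing fx≡fy (inj₂ uβ) (inj₁ L≡γ) (inj₁ R≡γ) = ⊥-elim (ι-height≢0 β (neg≡0⇒≡0 (trans
        (trans (cong -_ (sym h′+h″≡h))
               (solve 3 (λ a b c → :- (b :+ c) := (a :* con 0ℚ :- b :* con 1ℚ) :- c :* con 1ℚ) refl h h′ h″))
        (fβ-jump x∈ y∈ (not-crossing uβ) (crossing-γ L≡γ) (crossing-γ R≡γ) fx≡fy))))

      classify : ∀ {p} → p ≡ γ ⊎ Outside x y p → p ≡ γ ⊎ Unseparated x y p
      classify = Sum.map₂ (outside⇒unseparated (ℚ.<-trans x<γ γ<y))

    fβ-constant⇒γ∉ : fβ β L R x ≡ fβ β L R y → β ≢ γ × L ≢ γ × R ≢ γ
    fβ-constant⇒γ∉ fx≡fy with clear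
    ... | cβ ∷ cL ∷ cR ∷ _ = no-crossing fx≡fy (classify cβ) (classify cL) (classify cR)

Between : ℚ → ℚ → ℚ → Set
Between x y γ = (x < γ × γ < y) ⊎ (y < γ × γ < x)

¬between⇒sameSide : ∀ {x y γ} → x ≢ γ → y ≢ γ → ¬ Between x y γ → SameSide x y γ
¬between⇒sameSide x≢γ y≢γ ¬between =
  (λ x<γ → [ (λ y<γ → y<γ) , (λ γ<y → ⊥-elim (¬between (inj₁ (x<γ , γ<y)))) ]′ (<-connex y≢γ)) ,
  (λ y<γ → [ (λ x<γ → x<γ) , (λ γ<x → ⊥-elim (¬between (inj₂ (y<γ , γ<x)))) ]′ (<-connex x≢γ))

-- 0 is among the first points, so an arc from x to y free of them cannot wrap around through 0.
arc-free⇒¬between : ∀ {e n x y γ} → e 0 ≡ 0ℚ → InUnit y → ¬ InFirst e n y →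
                    (∀ s → InFirst e n s → ¬ InArc x y s) → InFirst e n γ → ¬ Between x y γ
arc-free⇒¬between _ _ _ arc-free γ-first (inj₁ (x<γ , γ<y)) =
  arc-free _ γ-first (inj₁ (ℚ.<-trans x<γ γ<y , x<γ , γ<y))
arc-free⇒¬between {e} e0≡0 (0≤y , _) y∉ arc-free _ (inj₂ (y<γ , γ<x)) =
  arc-free 0ℚ (0 , z≤n , e0≡0) (inj₂ (ℚ.<-trans y<γ γ<x , inj₂ 0<y))
  where
  0<y = ≤∧≢⇒< 0≤y (λ 0≡y → y∉ (0 , z≤n , trans e0≡0 0≡y))

sameComponent⇒unseparated : ∀ {e n x y γ} → e 0 ≡ 0ℚ → InUnit x → InUnit y → SameComponent e n x y →
                            InFirst e n γ → Unseparated x y γ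
sameComponent⇒unseparated {e} {n} e0≡0 x∈ y∈ (x∉ , y∉ , arc-free) γ-first =
  x≢γ , y≢γ , ¬between⇒sameSide x≢γ y≢γ ¬between
  where
  x≢γ = λ x≡γ → x∉ (subst (InFirst e n) (sym x≡γ) γ-first)
  y≢γ = λ y≡γ → y∉ (subst (InFirst e n) (sym y≡γ) γ-first)
  ¬between = [ (λ xy-free → arc-free⇒¬between e0≡0 y∈ y∉ xy-free γ-first)
             , (λ yx-free → arc-free⇒¬between e0≡0 x∈ x∉ yx-free γ-first ∘ Sum.swap) ]′ arc-free

outside⇒sameComponent : ∀ {e n x y} → x < y → (∀ s → InFirst e n s → Outside x y s) → SameComponent e n x y
outside⇒sameComponent {x = x} {y} x<y outside =
  (λ x-first → [ ℚ.<-irrefl refl , ℚ.<-asym x<y ]′ (outside x x-first)) ,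
  (λ y-first → [ ℚ.<-asym x<y , ℚ.<-irrefl refl ]′ (outside y y-first)) ,
  inj₁ arc-free
  where
  arc-free : ∀ s → InFirst _ _ s → ¬ InArc x y s
  arc-free s s-first (inj₁ (_ , x<s , s<y)) = [ ℚ.<-asym x<s , ℚ.<-asym s<y ]′ (outside s s-first)
  arc-free _ _       (inj₂ (y<x , _))       = ℚ.<-asym x<y y<x

firsts : (ℕ → ℚ) → ℕ → List ℚ
firsts e n = applyUpTo e (suc n)

lookup-first : ∀ {P : ℚ → Set} {e n s} → All P (firsts e n) → InFirst e n s → P s
lookup-first {P} {e} {n} all (k , k≤n , ek≡s) = subst P ek≡s (applyUpTo⁻ e (suc n) all (s≤s k≤n))

earlier⇒first : ∀ {e n} {P : ℚ → Set} → (∀ r → InUnit r → ∃ λ k → e k ≡ r) →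
                (∀ k → P (e k) → k ℕ.< n) → ∀ {γ} → InUnit γ → P γ → InFirst e n γ
earlier⇒first {P = P} onto earlier γ∈ Pγ with onto _ γ∈
... | k , ek≡γ = k , ℕ.<⇒≤ (earlier k (subst P (sym ek≡γ) Pγ)) , ek≡γ

nonzero⇒1≤index : ∀ {e : ℕ → ℚ} n → e 0 ≡ 0ℚ → e n ≢ 0ℚ → 1 ℕ.≤ n
nonzero⇒1≤index zero    e0≡0 e0≢0 = ⊥-elim (e0≢0 e0≡0)
nonzero⇒1≤index (suc _) _    _    = s≤s z≤n

admissible⇒measurable : ∀ {e} → IsEnumeration e → Admissible e → ∀ n → FMeasurable e n
admissible⇒measurable {e} (e∈ , _ , onto) (e0≡0 , left-earlier , right-earlier) n =
  (λ _ _ _ _ _ _ → refl) , fβ-measurable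
  where
  fβ-measurable : e n ≢ 0ℚ → ∀ β′ β″ → IsLeftNbr (e n) β′ → IsRightNbr (e n) β″ → Measurable e n (fβ (e n) β′ β″)
  fβ-measurable en≢0 β′ β″ isL isR x y x∈ y∈ x~y =
    fβ-cong x∈ y∈ (unseparated (n , ℕ.≤-refl , refl))
                  (unseparated (earlier⇒first onto (λ k → left-earlier n k 1≤n) (proj₁ isL) isL))
                  (unseparated (earlier⇒first onto (λ k → right-earlier n k 1≤n) (proj₁ isR) isR))
    where
    open Sawtooth (e∈ n) en≢0 isL isR
    1≤n = nonzero⇒1≤index {e} n e0≡0 en≢0
    unseparated : ∀ {γ} → InFirst e n γ → Unseparated x y γ
    unseparated = sameComponent⇒unseparated e0≡0 x∈ y∈ x~y

module _ {e : ℕ → ℚ} (enum : IsEnumeration e) (measurable : ∀ n → FMeasurable e n) where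

  private
    e∈ = proj₁ enum
    injective = proj₁ (proj₂ enum)

    0<e : ∀ n → e n ≢ 0ℚ → 0ℚ < e n
    0<e n en≢0 = ≤∧≢⇒< (proj₁ (e∈ n)) (λ 0≡en → en≢0 (sym 0≡en))

  -- With only e 0 placed the circle minus {e 0} is connected, yet f_{e 0} jumps at e 0 ≢ 0.
  e0≡0 : e 0 ≡ 0ℚ
  e0≡0 = decidable-stable (e 0 ℚ.≟ 0ℚ) e0≢0-absurd
    where
    e0≢0-absurd : e 0 ≢ 0ℚ → ⊥
    e0≢0-absurd e0≢0 = proj₁ (fβ-constant⇒γ∉ w fx≡fy) refl
      where
      open Neighbours (neighbours (e∈ 0) e0≢0)
      open Sawtooth (e∈ 0) e0≢0 isLeft isRight
      w = window (0<e 0 e0≢0) (proj₂ (e∈ 0)) (e 0 ∷ left ∷ right ∷ [])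
      open Window w
      first₀ : ∀ {s} → InFirst e 0 s → e 0 ≡ s
      first₀ (zero , _ , e0≡s) = e0≡s
      γ∉I[y,x] : ¬ InArc y x (e 0)
      γ∉I[y,x] (inj₁ (y<x , _))      = ℚ.<-asym y<x (ℚ.<-trans x<γ γ<y)
      γ∉I[y,x] (inj₂ (_ , inj₁ y<γ)) = ℚ.<-asym γ<y y<γ
      γ∉I[y,x] (inj₂ (_ , inj₂ γ<x)) = ℚ.<-asym x<γ γ<x
      x~y : SameComponent e 0 x y
      x~y = (λ x-first → <⇒≢ x<γ (sym (first₀ x-first))) ,
            (λ y-first → <⇒≢ γ<y (first₀ y-first)) ,
            inj₂ (λ s s-first → γ∉I[y,x] ∘ subst (InArc y x) (sym (first₀ s-first)))
      fx≡fy = proj₂ (measurable 0) e0≢0 left right isLeft isRight x y x∈ y∈ x~y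

  private
    nonzero : ∀ {m} → 1 ℕ.≤ m → e m ≢ 0ℚ
    nonzero {suc m} _ e[1+m]≡0 = ℕ.1+n≢0 (injective (suc m) 0 (trans e[1+m]≡0 (sym e0≡0)))

    later⇒> : ∀ {m k} → ¬ k ℕ.< m → e k ≢ e m → m ℕ.< k
    later⇒> k≮m ek≢em = ℕ.≤∧≢⇒< (ℕ.≮⇒≥ k≮m) (λ m≡k → ek≢em (cong e (sym m≡k)))

    -- A small window around a neighbour placed after e m lies in one component of the circle
    -- minus e 0 … e m, yet f_{e m} jumps across it.
    late-neighbour : ∀ {m k L R} → 1 ℕ.≤ m → m ℕ.< k → IsLeftNbr (e m) L → IsRightNbr (e m) R →
                     L ≡ e k ⊎ R ≡ e k → ⊥
    late-neighbour {m} {k} {L} {R} 1≤m m<k isL isR = [ proj₁ (proj₂ γ∉) , proj₂ (proj₂ γ∉) ]′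
      where
      open Sawtooth (e∈ m) (nonzero 1≤m) isL isR
      w = window (0<e k (nonzero (ℕ.<-trans 1≤m m<k))) (proj₂ (e∈ k)) (e m ∷ L ∷ R ∷ firsts e m)
      open Window w
      first-outside : ∀ s → InFirst e m s → Outside x y s
      first-outside s s-first@(j , j≤m , ej≡s) =
        [ (λ s≡ek → ⊥-elim (ℕ.<⇒≢ (ℕ.≤-<-trans j≤m m<k) (injective j k (trans ej≡s s≡ek)))) , (λ out → out) ]′
        (lookup-first (All.tail (All.tail (All.tail clear))) s-first)
      fx≡fy = proj₂ (measurable m) (nonzero 1≤m) L R isL isR x y x∈ y∈
                (outside⇒sameComponent (ℚ.<-trans x<γ γ<y) first-outside)
      γ∉ = fβ-constant⇒γ∉ w fx≡fy

  left-earlier : ∀ m k → 1 ℕ.≤ m → IsLeftNbr (e m) (e k) → k ℕ.< m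
  left-earlier m k 1≤m isL = decidable-stable (k ℕ.<? m) λ k≮m →
    late-neighbour 1≤m (later⇒> k≮m (proj₁ (proj₂ (proj₂ isL)))) isL
                   (Neighbours.isRight (neighbours (e∈ m) (nonzero 1≤m))) (inj₁ refl)

  right-earlier : ∀ m l → 1 ℕ.≤ m → IsRightNbr (e m) (e l) → l ℕ.< m
  right-earlier m l 1≤m isR = decidable-stable (l ℕ.<? m) λ l≮m →
    late-neighbour 1≤m (later⇒> l≮m (proj₁ (proj₂ (proj₂ isR))))
                   (Neighbours.isLeft (neighbours (e∈ m) (nonzero 1≤m))) isR (inj₂ refl)

  measurable⇒admissible : Admissible e
  measurable⇒admissible = e0≡0 , left-earlier , right-earlier

theorem6 : (e : ℕ → ℚ) → IsEnumeration e
    → (Admissible e → (∀ n → FMeasurable e n)) × ((∀ n → FMeasurable e n) → Admissible e)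
theorem6 e enum = admissible⇒measurable enum , measurable⇒admissible enum
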